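{- Let $T$ be a tree and $e=u_1u_2$ an edge of $T$. Let $U_1$ and $U_2$ be the vertex sets of the components of $T-e$ with $u_1\in U_1$ and $u_2\in U_2$. Suppose $G_1=T[U_1\cup\{u_2\}]$ admits a $3$-rs colouring $f_1$ and $G_2=T[U_2\cup\{u_1\}]$ admits a $3$-rs colouring $f_2$ such that $f_1(u_1)=f_2(u_1)$ and $f_1(u_2)=f_2(u_2)$. Then the function $f$ on $V(T)$ defined by $f(w)=f_i(w)$ for $w\in U_i$, $i=1,2$, is a $3$-rs colouring of $T$.
   Context: A $3$-restricted star colouring ($3$-rs colouring) of a graph $G$ is a map $f:V(G)\to\{0,1,2\}$ with $f(x)\neq f(y)$ for every edge $xy$ and with no path $x,y,z$ in $G$ such that $f(y)>f(x)=f(z)$. $T[S]$ denotes the subgraph of $T$ induced by $S$. -}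

module Defs where

open import Data.Nat using (ℕ; _≤_)
open import Data.Fin using (Fin; _<_)
open import Data.List using (List; []; _∷_; _++_; [_]; length)
open import Data.List.Relation.Unary.Linked using (Linked)
open import Data.List.Relation.Unary.Unique.Propositional using (Unique)
open import Data.Product using (_×_; Σ; _,_)
open import Data.Sum using (_⊎_)
open import Data.Empty using (⊥)
open import Relation.Nullary using (¬_)
open import Relation.Binary.PropositionalEquality using (_≡_; _≢_)

record Graph (n : ℕ) : Set₁ where
  field
    Adj   : Fin n → Fin n → Set
    sym   : ∀ {x y} → Adj x y → Adj y x
    irrefl : ∀ {x} → ¬ Adj x x
open Graph public

data Reach {n : ℕ} (G : Graph n) : Fin n → Fin n → Set where
  here : ∀ {x} → Reach G x x
  step : ∀ {x y z} → Adj G x y → Reach G y z → Reach G x z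

Connected : ∀ {n} → Graph n → Set
Connected G = ∀ x y → Reach G x y

IsCycle : ∀ {n} → Graph n → Fin n → List (Fin n) → Set
IsCycle G x rest = (2 ≤ length rest) × Unique (x ∷ rest) × Linked (Adj G) (x ∷ rest ++ [ x ])

Acyclic : ∀ {n} → Graph n → Set
Acyclic G = ∀ x rest → ¬ IsCycle G x rest

IsTree : ∀ {n} → Graph n → Set
IsTree G = Connected G × Acyclic G

deleteEdge : ∀ {n} → (G : Graph n) → Fin n → Fin n → Graph n
deleteEdge G u v = record
  { Adj = λ x y → Adj G x y × ¬ ((x ≡ u × y ≡ v) ⊎ (x ≡ v × y ≡ u))
  ; sym = λ { (a , nb) → Graph.sym G a , λ { (Data.Sum.inj₁ (p , q)) → nb (Data.Sum.inj₂ (q , p))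
                                           ; (Data.Sum.inj₂ (p , q)) → nb (Data.Sum.inj₁ (q , p)) } }
  ; irrefl = λ { (a , _) → Graph.irrefl G a }
  }

-- f is a 3-rs colouring of the induced subgraph G[S]
-- (f is given on all of V(G); only its values on S matter).
RS3On : ∀ {n} → (G : Graph n) → (S : Fin n → Set) → (Fin n → Fin 3) → Set
RS3On G S f =
  (∀ x y → S x → S y → Adj G x y → f x ≢ f y)
  × (∀ x y z → S x → S y → S z → Adj G x y → Adj G y z → x ≢ z →
       ¬ (f x < f y × f x ≡ f z))

RS3 : ∀ {n} → Graph n → (Fin n → Fin 3) → Set
RS3 G f = RS3On G (λ _ → Data.Unit.⊤) f
  where import Data.Unit

{-# OPTIONS --safe #-}
-- The 3-rs conditions are local: each one concerns a vertex y and neighbours of y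
-- only. By connectivity of T every vertex y lies in U₁ or U₂, and then every neighbour of y lies in Uᵢ ∪ {u₃₋ᵢ}, where f agrees with fᵢ
-- (at u₃₋ᵢ thanks to the compatibility hypotheses). So the conditions for f around
-- y are the conditions for fᵢ on Gᵢ.
module Submission where

open import Defs
open import Data.Unit using (⊤)
open import Data.Fin using (Fin; _≟_; _<_)
open import Data.Sum using (_⊎_; inj₁; inj₂; [_,_]′)
open import Data.Product using (Σ; _×_; _,_)
open import Relation.Nullary using (¬_; yes; no)
open import Relation.Binary.PropositionalEquality
  using (_≡_; _≢_; refl; trans; subst₂)
  renaming (sym to ≡-sym)

Reach-snoc : ∀ {n} {G : Graph n} {a x y} → Reach G a x → Adj G x y → Reach G a y
Reach-snoc here e = step e here
Reach-snoc (step e r) e′ = step e (Reach-snoc r e′)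

LocallyRS3At : ∀ {n} → Graph n → (Fin n → Fin 3) → Fin n → Set₁
LocallyRS3At {n} G f y =
  Σ (Fin n → Set) λ S → Σ (Fin n → Fin 3) λ g →
    RS3On G S g × (S y × f y ≡ g y) × (∀ x → Adj G y x → S x × f x ≡ g x)

RS3-of-locallyRS3At : ∀ {n} (G : Graph n) (f : Fin n → Fin 3) →
  (∀ y → LocallyRS3At G f y) → RS3 G f
RS3-of-locallyRS3At G f local = proper , star
  where
  proper : ∀ x y → ⊤ → ⊤ → Adj G x y → f x ≢ f y
  proper x y _ _ xy fx≡fy with local y
  ... | S , g , (g-proper , _) , (Sy , fy≡gy) , around
    with around x (Graph.sym G xy)
  ... | Sx , fx≡gx = g-proper x y Sx Sy xy (trans (≡-sym fx≡gx) (trans fx≡fy fy≡gy))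

  star : ∀ x y z → ⊤ → ⊤ → ⊤ → Adj G x y → Adj G y z → x ≢ z → ¬ (f x < f y × f x ≡ f z)
  star x y z _ _ _ xy yz x≢z (fx<fy , fx≡fz) with local y
  ... | S , g , (_ , g-star) , (Sy , fy≡gy) , around
    with around x (Graph.sym G xy) | around z yz
  ... | Sx , fx≡gx | Sz , fz≡gz =
    g-star x y z Sx Sy Sz xy yz x≢z
      (subst₂ _<_ fx≡gx fy≡gy fx<fy , trans (≡-sym fx≡gx) (trans fx≡fz fz≡gz))

-- D plays the role of G - ab: it keeps every edge of G not entering a or b.
module Side {n} (G D : Graph n) (a b : Fin n)
  (keeps : ∀ {x y} → Adj G x y → y ≢ a → y ≢ b → Adj D x y) where

  neighbour-in-closedSide : ∀ {x y} → Reach D a y → Adj G y x → Reach D a x ⊎ x ≡ b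
  neighbour-in-closedSide {x} ay yx with x ≟ a | x ≟ b
  ... | yes refl | _ = inj₁ here
  ... | no _ | yes x≡b = inj₂ x≡b
  ... | no x≢a | no x≢b = inj₁ (Reach-snoc ay (keeps yx x≢a x≢b))

  locallyRS3At-side : (g f : Fin n → Fin 3) →
    RS3On G (λ w → Reach D a w ⊎ w ≡ b) g →
    (∀ w → Reach D a w → f w ≡ g w) → f b ≡ g b →
    ∀ y → Reach D a y → LocallyRS3At G f y
  locallyRS3At-side g f g-rs f≡g fb≡gb y ay =
    _ , g , g-rs , (inj₁ ay , f≡g y ay) , around
    where
    around : ∀ x → Adj G y x → (Reach D a x ⊎ x ≡ b) × f x ≡ g x
    around x yx with neighbour-in-closedSide ay yx
    ... | inj₁ ax = inj₁ ax , f≡g x ax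
    ... | inj₂ refl = inj₂ refl , fb≡gb

module EdgeDeletion {n} (G : Graph n) (u₁ u₂ : Fin n) where
  open Graph (deleteEdge G u₁ u₂) using () renaming (Adj to Adj⁻)

  deleteEdge-keeps : ∀ {x y} → Adj G x y → y ≢ u₁ → y ≢ u₂ → Adj⁻ x y
  deleteEdge-keeps xy y≢u₁ y≢u₂ =
    xy , [ (λ { (_ , y≡u₂) → y≢u₂ y≡u₂ }) , (λ { (_ , y≡u₁) → y≢u₁ y≡u₁ }) ]′

  module Side₁ = Side G (deleteEdge G u₁ u₂) u₁ u₂ deleteEdge-keeps
  module Side₂ = Side G (deleteEdge G u₁ u₂) u₂ u₁ (λ xy p q → deleteEdge-keeps xy q p)

  InSomeSide : Fin n → Set
  InSomeSide w = Reach (deleteEdge G u₁ u₂) u₁ w ⊎ Reach (deleteEdge G u₁ u₂) u₂ w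

  InSomeSide-step : ∀ {x y} → InSomeSide x → Adj G x y → InSomeSide y
  InSomeSide-step (inj₁ s) xy =
    [ inj₁ , (λ { refl → inj₂ here }) ]′ (Side₁.neighbour-in-closedSide s xy)
  InSomeSide-step (inj₂ s) xy =
    [ inj₂ , (λ { refl → inj₁ here }) ]′ (Side₂.neighbour-in-closedSide s xy)

  InSomeSide-reach : ∀ {x w} → InSomeSide x → Reach G x w → InSomeSide w
  InSomeSide-reach s here = s
  InSomeSide-reach s (step xy r) = InSomeSide-reach (InSomeSide-step s xy) r

  InSomeSide-connected : Connected G → ∀ w → InSomeSide w
  InSomeSide-connected conn w = InSomeSide-reach (inj₁ here) (conn u₁ w)

lemma2 : ∀ {n} (T : Graph n) → IsTree T →
    (u₁ u₂ : Fin n) → Adj T u₁ u₂ →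
    (f₁ f₂ : Fin n → Fin 3) →
    RS3On T (λ w → Reach (deleteEdge T u₁ u₂) u₁ w ⊎ w ≡ u₂) f₁ →
    RS3On T (λ w → Reach (deleteEdge T u₁ u₂) u₂ w ⊎ w ≡ u₁) f₂ →
    f₁ u₁ ≡ f₂ u₁ → f₁ u₂ ≡ f₂ u₂ →
    (f : Fin n → Fin 3) →
    (∀ w → Reach (deleteEdge T u₁ u₂) u₁ w → f w ≡ f₁ w) →
    (∀ w → Reach (deleteEdge T u₁ u₂) u₂ w → f w ≡ f₂ w) →
    RS3 T f
lemma2 T (connected , _) u₁ u₂ _ f₁ f₂ rs₁ rs₂ agree₁ agree₂ f f≡f₁ f≡f₂ =
  RS3-of-locallyRS3At T f local
  where
  open EdgeDeletion T u₁ u₂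

  fu₂≡f₁u₂ : f u₂ ≡ f₁ u₂
  fu₂≡f₁u₂ = trans (f≡f₂ u₂ here) (≡-sym agree₂)

  fu₁≡f₂u₁ : f u₁ ≡ f₂ u₁
  fu₁≡f₂u₁ = trans (f≡f₁ u₁ here) agree₁

  local : ∀ y → LocallyRS3At T f y
  local y with InSomeSide-connected connected y
  ... | inj₁ s = Side₁.locallyRS3At-side f₁ f rs₁ f≡f₁ fu₂≡f₁u₂ y s
  ... | inj₂ s = Side₂.locallyRS3At-side f₂ f rs₂ f≡f₂ fu₁≡f₂u₁ y s
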